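{- Let $\mathbf{L}\in\{\mathbf{K},\mathbf{T},\mathbf{K4},\mathbf{S4}\}$. Then $\mathbf{L}^{Horn,\Box}$ is closed under intersection of models: for every $\mathbf{L}^{Horn,\Box}$-formula $\varphi$, every frame $\mathcal F=(W,R)$ in the frame class of $\mathbf{L}$, every two valuations $V_1,V_2$ on $\mathcal F$ and every $w\in W$, if $(\mathcal F,V_1),w\models\varphi$ and $(\mathcal F,V_2),w\models\varphi$, then $(\mathcal F,V_{1}\cap V_2),w\models\varphi$, where $(V_1\cap V_2)(u)=V_1(u)\cap V_2(u)$ for all $u\in W$.
   Context: Fix a countable set $\mathcal P$ of propositional letters; Kripke models are $(\mathcal F,V)$ with $\mathcal F=(W,R)$ a frame and $V:W\to 2^{\mathcal P}$, with standard modal satisfaction. $\mathbf{K},\mathbf{T},\mathbf{K4},\mathbf{S4}$ are interpreted over all, reflexive, transitive, and reflexive-transitive frames respectively. Box positive literals: $\lambda ::= \top\mid p\mid \Box\lambda$ ($p\in\mathcal P$). An $\mathbf{L}^{Horn,\Box}$-formula is a finite conjunction of clauses of the form $\Box^s(\neg\lambda_1\vee\dots\vee\neg\lambda_n\vee\lambda_{n+1}\vee\dots\vee\lambda_{n+m})$ with $s,n\ge 0$, $m\le 1$, each $\lambda_i$ a box positive literal ($\Box^s$ denotes $s$ nested boxes; $\bot:=\neg\top$). -}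

module Defs where

open import Data.Nat using (ℕ; zero; suc)
open import Data.Bool using (Bool; true; _∧_)
open import Data.List using (List; []; _∷_)
open import Data.Empty using (⊥)
open import Data.Unit using (⊤)
open import Data.Product using (_×_)
open import Data.Sum using (_⊎_)
open import Relation.Binary.PropositionalEquality using (_≡_)

Letter : Set
Letter = ℕ

data Form : Set where
  ⊤ᶠ  : Form
  var : Letter → Form
  ¬ᶠ_ : Form → Form
  _∧ᶠ_ : Form → Form → Form
  _∨ᶠ_ : Form → Form → Form
  □_  : Form → Form

⊥ᶠ : Form
⊥ᶠ = ¬ᶠ ⊤ᶠ

record Frame : Set₁ where
  field
    W : Set
    R : W → W → Set
open Frame public

-- A valuation assigns to each world a subset of the letters (as characteristic function).
Valuation : Frame → Set
Valuation F = W F → Letter → Bool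

_,_,_⊨_ : (F : Frame) → Valuation F → W F → Form → Set
F , V , w ⊨ ⊤ᶠ = ⊤
F , V , w ⊨ var p = V w p ≡ true
F , V , w ⊨ (¬ᶠ φ) = (F , V , w ⊨ φ) → ⊥
F , V , w ⊨ (φ ∧ᶠ ψ) = (F , V , w ⊨ φ) × (F , V , w ⊨ ψ)
F , V , w ⊨ (φ ∨ᶠ ψ) = (F , V , w ⊨ φ) ⊎ (F , V , w ⊨ ψ)
F , V , w ⊨ (□ φ) = ∀ v → R F w v → F , V , v ⊨ φ

_∩ᵛ_ : {F : Frame} → Valuation F → Valuation F → Valuation F
(V₁ ∩ᵛ V₂) u p = V₁ u p ∧ V₂ u p

data Logic : Set where
  K T K4 S4 : Logic

Reflexive : Frame → Set
Reflexive F = ∀ w → R F w w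

Transitive : Frame → Set
Transitive F = ∀ u v w → R F u v → R F v w → R F u w

InFrameClass : Logic → Frame → Set
InFrameClass K  F = ⊤
InFrameClass T  F = Reflexive F
InFrameClass K4 F = Transitive F
InFrameClass S4 F = Reflexive F × Transitive F

□^ : ℕ → Form → Form
□^ zero φ = φ
□^ (suc n) φ = □ (□^ n φ)

data BoxPosLit : Form → Set where
  bpl-⊤ : BoxPosLit ⊤ᶠ
  bpl-p : ∀ p → BoxPosLit (var p)
  bpl-□ : ∀ {φ} → BoxPosLit φ → BoxPosLit (□ φ)

bigOr : List Form → Form
bigOr [] = ⊥ᶠ
bigOr (φ ∷ []) = φ
bigOr (φ ∷ φs@(_ ∷ _)) = φ ∨ᶠ bigOr φs

negs : List Form → List Form
negs [] = []
negs (φ ∷ φs) = (¬ᶠ φ) ∷ negs φs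

_++ᶠ_ : List Form → List Form → List Form
[] ++ᶠ ys = ys
(x ∷ xs) ++ᶠ ys = x ∷ (xs ++ᶠ ys)

data AllBPL : List Form → Set where
  []  : AllBPL []
  _∷_ : ∀ {φ φs} → BoxPosLit φ → AllBPL φs → AllBPL (φ ∷ φs)

data HornClause : Form → Set where
  clause-neg : ∀ s ns → AllBPL ns →
               HornClause (□^ s (bigOr (negs ns)))
  clause-pos : ∀ s ns {l} → AllBPL ns → BoxPosLit l →
               HornClause (□^ s (bigOr (negs ns ++ᶠ (l ∷ []))))

bigAnd : List Form → Form
bigAnd [] = ⊤ᶠ
bigAnd (φ ∷ []) = φ
bigAnd (φ ∷ φs@(_ ∷ _)) = φ ∧ᶠ bigAnd φs

data AllClauses : List Form → Set where
  []  : AllClauses []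
  _∷_ : ∀ {φ φs} → HornClause φ → AllClauses φs → AllClauses (φ ∷ φs)

data HornBox : Form → Set where
  horn : ∀ cs → AllClauses cs → HornBox (bigAnd cs)

-- Intersecting valuations acts on a box positive literal λ as a meet: λ holds
-- under V₁ ∩ V₂ exactly when it holds under both V₁ and V₂, since □ commutes
-- with conjunction. Hence a negated literal ¬λ that holds under one of the
-- valuations holds under the intersection, and a disjunction of negated literals
-- with at most one positive literal survives: either some ¬λᵢ holds under V₁ or
-- under V₂, or the positive literal holds under both. Boxes and conjunctions
-- preserve the property, and no frame condition is used.
module Submission where

open import Defs
open import Data.Bool using (_∧_)
open import Data.Bool.Properties using (∧-conicalˡ; ∧-conicalʳ)
open import Data.List using ([]; _∷_)
open import Data.Nat using (zero; suc)
open import Data.Product using (_×_; _,_; proj₁; proj₂)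
open import Data.Sum using (inj₁; inj₂)
open import Data.Unit using (tt)
open import Relation.Binary.PropositionalEquality using (_≡_; refl; cong; cong₂; subst)

Intersective : Frame → Form → Set
Intersective F φ = ∀ (V₁ V₂ : Valuation F) w →
  F , V₁ , w ⊨ φ → F , V₂ , w ⊨ φ → F , _∩ᵛ_ {F} V₁ V₂ , w ⊨ φ

module _ {F : Frame} {V₁ V₂ : Valuation F} where

  ⊨-bpl-∩⁻ : ∀ {l} → BoxPosLit l → ∀ w →
    F , _∩ᵛ_ {F} V₁ V₂ , w ⊨ l → (F , V₁ , w ⊨ l) × (F , V₂ , w ⊨ l)
  ⊨-bpl-∩⁻ bpl-⊤     w _ = tt , tt
  ⊨-bpl-∩⁻ (bpl-p p) w h = ∧-conicalˡ (V₁ w p) (V₂ w p) h , ∧-conicalʳ (V₁ w p) (V₂ w p) h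
  ⊨-bpl-∩⁻ (bpl-□ b) w h =
    (λ v r → proj₁ (⊨-bpl-∩⁻ b v (h v r))) , (λ v r → proj₂ (⊨-bpl-∩⁻ b v (h v r)))

  ⊨-¬bpl-∩ˡ : ∀ {l} → BoxPosLit l → ∀ w →
    F , V₁ , w ⊨ (¬ᶠ l) → F , _∩ᵛ_ {F} V₁ V₂ , w ⊨ (¬ᶠ l)
  ⊨-¬bpl-∩ˡ b w h₁ h = h₁ (proj₁ (⊨-bpl-∩⁻ b w h))

  ⊨-¬bpl-∩ʳ : ∀ {l} → BoxPosLit l → ∀ w →
    F , V₂ , w ⊨ (¬ᶠ l) → F , _∩ᵛ_ {F} V₁ V₂ , w ⊨ (¬ᶠ l)
  ⊨-¬bpl-∩ʳ b w h₂ h = h₂ (proj₂ (⊨-bpl-∩⁻ b w h))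

module _ {F : Frame} where

  bpl-intersective : ∀ {l} → BoxPosLit l → Intersective F l
  bpl-intersective bpl-⊤     V₁ V₂ w _  _  = tt
  bpl-intersective (bpl-p p) V₁ V₂ w h₁ h₂ = cong₂ _∧_ h₁ h₂
  bpl-intersective (bpl-□ b) V₁ V₂ w h₁ h₂ v r = bpl-intersective b V₁ V₂ v (h₁ v r) (h₂ v r)

  ⊥-intersective : Intersective F ⊥ᶠ
  ⊥-intersective V₁ V₂ w h₁ _ = h₁

  ¬bpl-intersective : ∀ {l} → BoxPosLit l → Intersective F (¬ᶠ l)
  ¬bpl-intersective b V₁ V₂ w h₁ _ = ⊨-¬bpl-∩ˡ b w h₁

  ¬bpl-∨-intersective : ∀ {l ψ} → BoxPosLit l → Intersective F ψ →
    Intersective F ((¬ᶠ l) ∨ᶠ ψ)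
  ¬bpl-∨-intersective b _  V₁ V₂ w (inj₁ h₁) _         = inj₁ (⊨-¬bpl-∩ˡ b w h₁)
  ¬bpl-∨-intersective b _  V₁ V₂ w (inj₂ _)  (inj₁ h₂) = inj₁ (⊨-¬bpl-∩ʳ b w h₂)
  ¬bpl-∨-intersective b ψ∩ V₁ V₂ w (inj₂ h₁) (inj₂ h₂) = inj₂ (ψ∩ V₁ V₂ w h₁ h₂)

  bigOr-negs-intersective : ∀ {ns} ψs → AllBPL ns → Intersective F (bigOr ψs) →
    Intersective F (bigOr (negs ns ++ᶠ ψs))
  bigOr-negs-intersective ψs [] ψs∩ = ψs∩
  bigOr-negs-intersective {_ ∷ []}    []      (b ∷ []) _   = ¬bpl-intersective b
  bigOr-negs-intersective {_ ∷ []}    (_ ∷ _) (b ∷ []) ψs∩ = ¬bpl-∨-intersective b ψs∩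
  bigOr-negs-intersective {_ ∷ _ ∷ _} ψs      (b ∷ bs) ψs∩ =
    ¬bpl-∨-intersective b (bigOr-negs-intersective ψs bs ψs∩)

  □^-intersective : ∀ s {φ} → Intersective F φ → Intersective F (□^ s φ)
  □^-intersective zero    φ∩ = φ∩
  □^-intersective (suc s) φ∩ V₁ V₂ w h₁ h₂ v r = □^-intersective s φ∩ V₁ V₂ v (h₁ v r) (h₂ v r)

  ++ᶠ-identityʳ : ∀ φs → φs ++ᶠ [] ≡ φs
  ++ᶠ-identityʳ []       = refl
  ++ᶠ-identityʳ (φ ∷ φs) = cong (φ ∷_) (++ᶠ-identityʳ φs)

  hornClause-intersective : ∀ {φ} → HornClause φ → Intersective F φ
  hornClause-intersective (clause-neg s ns bs) =
    □^-intersective s (subst (λ φs → Intersective F (bigOr φs)) (++ᶠ-identityʳ (negs ns))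
      (bigOr-negs-intersective [] bs ⊥-intersective))
  hornClause-intersective (clause-pos s ns bs b) =
    □^-intersective s (bigOr-negs-intersective (_ ∷ []) bs (bpl-intersective b))

  bigAnd-intersective : ∀ {cs} → AllClauses cs → Intersective F (bigAnd cs)
  bigAnd-intersective []       V₁ V₂ w _ _ = tt
  bigAnd-intersective {_ ∷ []} (c ∷ []) = hornClause-intersective c
  bigAnd-intersective {_ ∷ _ ∷ _} (c ∷ cs) V₁ V₂ w (h₁ , hs₁) (h₂ , hs₂) =
    hornClause-intersective c V₁ V₂ w h₁ h₂ , bigAnd-intersective cs V₁ V₂ w hs₁ hs₂

hornBox-intersective : ∀ {F φ} → HornBox φ → Intersective F φ
hornBox-intersective (horn _ cs) = bigAnd-intersective cs

lemma3p5 : (L : Logic) (φ : Form) → HornBox φ →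
    (F : Frame) → InFrameClass L F →
    (V₁ V₂ : Valuation F) (w : W F) →
    F , V₁ , w ⊨ φ → F , V₂ , w ⊨ φ →
    F , (_∩ᵛ_ {F} V₁ V₂) , w ⊨ φ
lemma3p5 _ _ hφ _ _ = hornBox-intersective hφ
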